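{- Let $\pi$ be a uniformly random permutation of $[n]$, let $k$ and $l$ be integers with $\frac{k}{2}<l\le k-2$, and let $j\ge 1$ with $j+2k-l-1\le n$. Let $I_{j,l,k}$ be the indicator of the event that $(\pi(j),\dots,\pi(j+k-1))$ and $(\pi(j+k-l),\dots,\pi(j+2k-l-1))$ (two windows of length $k$ overlapping in exactly $l$ positions) are order isomorphic. Then \[\mathbb{P}(I_{j,l,k}=1)\le\left(\frac{1}{(k-l)!}\right)^{\frac{k}{k-l}-1}.\]
   Context: Two sequences of distinct numbers of the same length $k$ are order isomorphic if for all $i,j\in[k]$, the $i$th entry is smaller than the $j$th entry in one sequence iff the same holds in the other. -}

module Defs where

open import Data.Nat using (ℕ; zero; suc; _<_; _<?_; _+_; _∸_)
open import Data.Nat.Properties using ()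
open import Data.Fin using (Fin; toℕ; fromℕ<)
open import Data.Fin.Properties using (all?) renaming (_≟_ to _≟ᶠ_)
open import Data.Vec using (Vec; []; _∷_; lookup)
open import Data.List using (List; []; _∷_; map; concatMap; filter; length)
open import Data.Product using (_×_)
open import Function.Bundles using (_⇔_)
open import Relation.Binary.PropositionalEquality using (_≡_)
open import Relation.Nullary using (Dec; yes; no)
open import Relation.Nullary.Decidable using (_→-dec_; _×-dec_)
open import Relation.Unary using (Decidable)

allFinL : (m : ℕ) → List (Fin m)
allFinL zero = []
allFinL (suc m) = Data.Fin.zero ∷ map Data.Fin.suc (allFinL m)

allVecs : (n m : ℕ) → List (Vec (Fin m) n)
allVecs zero m = [] ∷ []
allVecs (suc n) m = concatMap (λ x → map (x ∷_) (allVecs n m)) (allFinL m)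

-- A vector π : Vec (Fin n) n represents the map i ↦ lookup π i (0-based);
-- it is a permutation of [n] iff this map is injective.
IsPerm : {n : ℕ} → Vec (Fin n) n → Set
IsPerm {n} π = (a b : Fin n) → lookup π a ≡ lookup π b → a ≡ b

isPerm? : {n : ℕ} → Decidable (IsPerm {n})
isPerm? π = all? λ a → all? λ b → (lookup π a ≟ᶠ lookup π b) →-dec (a ≟ᶠ b)

-- Value of π at 0-based position m (as a natural number); 0 outside range
-- (never used out of range under the lemma's hypotheses).
at : {n : ℕ} → Vec (Fin n) n → ℕ → ℕ
at {n} π m with m <? n
... | yes p = toℕ (lookup π (fromℕ< p))
... | no _ = 0

OrderIsoWindows : {n : ℕ} → (k s t : ℕ) → Vec (Fin n) n → Set
OrderIsoWindows k s t π =
  (a b : Fin k) →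
    ((at π (s + toℕ a) < at π (s + toℕ b)) → (at π (t + toℕ a) < at π (t + toℕ b)))
  × ((at π (t + toℕ a) < at π (t + toℕ b)) → (at π (s + toℕ a) < at π (s + toℕ b)))

orderIsoWindows? : {n : ℕ} → (k s t : ℕ) → Decidable (OrderIsoWindows {n} k s t)
orderIsoWindows? k s t π = all? λ a → all? λ b →
  ((at π (s + toℕ a) <? at π (s + toℕ b)) →-dec (at π (t + toℕ a) <? at π (t + toℕ b)))
  ×-dec
  ((at π (t + toℕ a) <? at π (t + toℕ b)) →-dec (at π (s + toℕ a) <? at π (s + toℕ b)))

-- Event I_{j,l,k} = 1 (j is 1-based as in the paper): the windows
-- (π(j),...,π(j+k-1)) and (π(j+k-l),...,π(j+2k-l-1)) are order isomorphic.
-- In 0-based positions these start at j-1 and j-1+k-l.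
Ijlk : {n : ℕ} → (j l k : ℕ) → Vec (Fin n) n → Set
Ijlk j l k π = OrderIsoWindows k (j ∸ 1) (j ∸ 1 + (k ∸ l)) π

Ijlk? : {n : ℕ} → (j l k : ℕ) → Decidable (Ijlk {n} j l k)
Ijlk? j l k π = orderIsoWindows? k (j ∸ 1) (j ∸ 1 + (k ∸ l)) π

perms : (n : ℕ) → List (Vec (Fin n) n)
perms n = filter isPerm? (allVecs n n)

-- Number of permutations π of [n] with I_{j,l,k} = 1.
-- P(I_{j,l,k} = 1) = countI n j l k / n!.
countI : (n j l k : ℕ) → ℕ
countI n j l k = length (filter (Ijlk? j l k) (perms n))

-- Put d = k − l. Since the two windows overlap in a shift by d, their order isomorphism makes the
-- pattern of π periodic with period d along the first window; hence the q = ⌊l/d⌋ + 1 consecutive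
-- length-d blocks following the first block (all inside the second window, as q·d ≤ k) have the same
-- pattern as the first block. Permuting the entries of each such block by an arbitrary permutation of
-- [d] is injective on these π, because the untouched first block remembers the common pattern and so
-- determines the permutations. Hence the number of π with I = 1 is at most n!/(d!)^q, and l ≤ q·d
-- turns this into the claimed bound.
module Submission where

open import Defs

open import Data.Nat using (ℕ; zero; suc; z<s; _+_; _*_; _^_; _∸_; _≤_; _<_; z≤n; s≤s; _!; _<?_; _≤?_; NonZero; >-nonZero; _/_; _%_)
open import Data.Nat.DivMod using (m≡m%n+[m/n]*n; m%n<n; m/n*n≤m)
open import Data.Nat.Properties
open import Data.List using (List; []; _∷_; map; concatMap; filter; length; _++_; cartesianProductWith)
open import Data.Vec using (Vec; []; _∷_; lookup; tabulate)
import Data.Vec.Properties as Vec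
open import Data.Fin using (Fin; toℕ; fromℕ<; punchOut) renaming (zero to fzero; suc to fsuc)
import Data.Fin.Properties as Fin
open import Data.List.Properties using (length-filter; filter-notAll; filter-++; length-++; length-map; filter-≐; filter-none; filter-all)
open import Data.List.Membership.Propositional using (_∈_; _∉_)
open import Data.List.Membership.Propositional.Properties using (∈-map⁻; ∈-filter⁺; ∈-filter⁻; ∈-cartesianProductWith⁻; ∈-cartesianProductWith⁺; ∈-map⁺)
open import Data.List.Relation.Binary.Subset.Propositional using (_⊆_)
open import Data.List.Relation.Unary.Any as Any using (here; there)
open import Data.List.Relation.Unary.All as All using (All; []; _∷_)
open import Data.List.Relation.Unary.AllPairs using ([]; _∷_)
open import Data.List.Relation.Unary.Unique.Propositional using (Unique)
open import Data.List.Relation.Unary.Unique.Propositional.Properties using (++⁺; filter⁺; cartesianProductWith⁺)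
open import Data.Product using (_×_; _,_; proj₁; proj₂; ∃; swap)
open import Data.Sum using (_⊎_; inj₁; inj₂)
open import Function using (Injective; _∘_; case_of_; _⇔_; mk⇔; Equivalence)
open import Data.Empty using (⊥-elim)
open import Level using (0ℓ)
open import Relation.Binary.Definitions using (DecidableEquality; tri<; tri≈; tri>)
open import Relation.Binary.PropositionalEquality using (_≡_; _≢_; _≗_; refl; sym; trans; cong; cong₂; subst; subst₂; module ≡-Reasoning)
open import Relation.Nullary using (Dec; yes; no; ¬_; ¬?)
open import Relation.Unary using (Pred; Decidable; _≐_)
open import Relation.Unary.Properties using (U?)
open import Relation.Nullary.Decidable using (_→-dec_; _×-dec_)

private variable
  A B C : Set

module _ (_≟_ : DecidableEquality A) where

  unique⇒length-≤ : ∀ {xs ys : List A} → Unique xs → xs ⊆ ys → length xs ≤ length ys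
  unique⇒length-≤ {[]} _ _ = z≤n
  unique⇒length-≤ {x ∷ xs} {ys} (x∉xs ∷ xs!) xs⊆ys = begin
    suc (length xs)              ≤⟨ s≤s (unique⇒length-≤ xs! xs⊆ys-x) ⟩
    suc (length (filter x≢? ys)) ≤⟨ filter-notAll x≢? ys (Any.map (λ x≡y x≢y → x≢y x≡y) (xs⊆ys (here refl))) ⟩
    length ys                    ∎
    where
    open ≤-Reasoning
    x≢? : Decidable (λ y → ¬ x ≡ y)
    x≢? y = ¬? (x ≟ y)
    xs⊆ys-x : xs ⊆ filter x≢? ys
    xs⊆ys-x y∈xs = ∈-filter⁺ x≢? (xs⊆ys (there y∈xs)) (All.lookup x∉xs y∈xs)

unique-map : {f : A → B} {xs : List A} → Unique xs →
  (∀ {x y} → x ∈ xs → y ∈ xs → f x ≡ f y → x ≡ y) → Unique (map f xs)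
unique-map {xs = []} [] _ = []
unique-map {f = f} {xs = x ∷ xs} (x∉xs ∷ xs!) f-inj =
  All.tabulate fx≢ ∷ unique-map xs! (λ x∈ y∈ → f-inj (there x∈) (there y∈))
  where
  fx≢ : ∀ {z} → z ∈ map f xs → f x ≢ z
  fx≢ z∈ fx≡z with y , y∈xs , refl ← ∈-map⁻ f z∈ = All.lookup x∉xs y∈xs (f-inj (here refl) (there y∈xs) fx≡z)

module _ (f : A → B → C) where

  length-cartesianProductWith : ∀ xs ys → length (cartesianProductWith f xs ys) ≡ length xs * length ys
  length-cartesianProductWith [] ys = refl
  length-cartesianProductWith (x ∷ xs) ys = begin
    length (map (f x) ys ++ cartesianProductWith f xs ys)          ≡⟨ length-++ (map (f x) ys) ⟩
    length (map (f x) ys) + length (cartesianProductWith f xs ys)  ≡⟨ cong₂ _+_ (length-map (f x) ys) (length-cartesianProductWith xs ys) ⟩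
    length ys + length xs * length ys                              ∎
    where open ≡-Reasoning

  unique-cartesianProductWith : ∀ {xs ys} → Unique xs → Unique ys →
    (∀ {x x′ y y′} → x ∈ xs → x′ ∈ xs → y ∈ ys → y′ ∈ ys → f x y ≡ f x′ y′ → x ≡ x′ × y ≡ y′) →
    Unique (cartesianProductWith f xs ys)
  unique-cartesianProductWith {[]} _ _ _ = []
  unique-cartesianProductWith {x ∷ xs} {ys} (x∉xs ∷ xs!) ys! f-inj =
    ++⁺ (unique-map ys! (λ y∈ y′∈ → proj₂ ∘ f-inj (here refl) (here refl) y∈ y′∈))
        (unique-cartesianProductWith xs! ys! (λ x∈ x′∈ → f-inj (there x∈) (there x′∈)))
        disjoint
    where
    disjoint : ∀ {v} → ¬ (v ∈ map (f x) ys × v ∈ cartesianProductWith f xs ys)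
    disjoint (v∈ , v∈′) with y , y∈ys , refl ← ∈-map⁻ (f x) v∈
                           | x′ , y′ , x′∈xs , y′∈ys , fxy≡ ← ∈-cartesianProductWith⁻ f xs ys v∈′ =
      All.lookup x∉xs x′∈xs (proj₁ (f-inj (here refl) (there x′∈xs) y∈ys y′∈ys fxy≡))

  length-*-≤ : DecidableEquality C → ∀ {xs ys zs} → Unique xs → Unique ys →
    (∀ {x x′ y y′} → x ∈ xs → x′ ∈ xs → y ∈ ys → y′ ∈ ys → f x y ≡ f x′ y′ → x ≡ x′ × y ≡ y′) →
    (∀ {x y} → x ∈ xs → y ∈ ys → f x y ∈ zs) →
    length xs * length ys ≤ length zs
  length-*-≤ _≟_ {xs} {ys} xs! ys! f-inj f∈ = subst (_≤ _) (length-cartesianProductWith xs ys)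
    (unique⇒length-≤ _≟_ (unique-cartesianProductWith xs! ys! f-inj) image⊆)
    where
    image⊆ : cartesianProductWith f xs ys ⊆ _
    image⊆ v∈ with x , y , x∈ , y∈ , refl ← ∈-cartesianProductWith⁻ f xs ys v∈ = f∈ x∈ y∈

module _ {P : Pred B 0ℓ} (P? : Decidable P) (f : A → B) where

  length-filter-map : ∀ xs → length (filter P? (map f xs)) ≡ length (filter (P? ∘ f) xs)
  length-filter-map [] = refl
  length-filter-map (x ∷ xs) with P? (f x)
  ... | yes _ = cong suc (length-filter-map xs)
  ... | no _ = length-filter-map xs

module _ {P Q : Pred A 0ℓ} (P? : Decidable P) (Q? : Decidable Q) (P⇒Q : ∀ {x} → P x → Q x) where

  filter-filter-⇒ : ∀ xs → filter P? (filter Q? xs) ≡ filter P? xs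
  filter-filter-⇒ [] = refl
  filter-filter-⇒ (x ∷ xs) with Q? x
  ... | yes _ with P? x
  ...   | yes _ = cong (x ∷_) (filter-filter-⇒ xs)
  ...   | no _ = filter-filter-⇒ xs
  filter-filter-⇒ (x ∷ xs) | no ¬q with P? x
  ...   | yes p = ⊥-elim (¬q (P⇒Q p))
  ...   | no _ = filter-filter-⇒ xs

  length-filter-mono : ∀ xs → length (filter P? xs) ≤ length (filter Q? xs)
  length-filter-mono xs = subst (_≤ _) (cong length (filter-filter-⇒ xs)) (length-filter P? (filter Q? xs))

  length-filter-mono-< : ∀ {x xs} → x ∈ xs → Q x → ¬ P x → length (filter P? xs) < length (filter Q? xs)
  length-filter-mono-< {x} {xs} x∈xs qx ¬px = subst (_< _) (cong length (filter-filter-⇒ xs))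
    (filter-notAll P? (filter Q? xs) (Any.map (λ { refl → ¬px }) (∈-filter⁺ Q? x∈xs qx)))

module _ {P : Pred A 0ℓ} {R : Pred C 0ℓ} (P? : Decidable P) (R? : Decidable R) (f : A → B → C) (ys : List B) (c : ℕ)
  (count-P : ∀ x → P x → length (filter (R? ∘ f x) ys) ≡ c)
  (count-¬P : ∀ x → ¬ P x → length (filter (R? ∘ f x) ys) ≡ 0) where

  length-filter-cartesianProductWith : ∀ xs →
    length (filter R? (cartesianProductWith f xs ys)) ≡ length (filter P? xs) * c
  length-filter-cartesianProductWith [] = refl
  length-filter-cartesianProductWith (x ∷ xs) = begin
    length (filter R? (map (f x) ys ++ cartesianProductWith f xs ys))
      ≡⟨ cong length (filter-++ R? (map (f x) ys) _) ⟩
    length (filter R? (map (f x) ys) ++ filter R? (cartesianProductWith f xs ys))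
      ≡⟨ length-++ (filter R? (map (f x) ys)) ⟩
    length (filter R? (map (f x) ys)) + length (filter R? (cartesianProductWith f xs ys))
      ≡⟨ cong₂ _+_ (length-filter-map R? (f x) ys) (length-filter-cartesianProductWith xs) ⟩
    length (filter (R? ∘ f x) ys) + length (filter P? xs) * c
      ≡⟨ head-term ⟩
    length (filter P? (x ∷ xs)) * c ∎
    where
    open ≡-Reasoning
    head-term : length (filter (R? ∘ f x) ys) + length (filter P? xs) * c
                     ≡ length (filter P? (x ∷ xs)) * c
    head-term with P? x
    ... | yes p = cong (_+ _) (count-P x p)
    ... | no ¬p = cong (_+ _) (count-¬P x ¬p)

concatMap-map≡cartesianProductWith : (f : A → B → C) (xs : List A) (ys : List B) →
  concatMap (λ x → map (f x) ys) xs ≡ cartesianProductWith f xs ys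
concatMap-map≡cartesianProductWith f [] ys = refl
concatMap-map≡cartesianProductWith f (x ∷ xs) ys = cong (map (f x) ys ++_) (concatMap-map≡cartesianProductWith f xs ys)

∈-allFinL : ∀ {m} (x : Fin m) → x ∈ allFinL m
∈-allFinL fzero = here refl
∈-allFinL (fsuc x) = there (∈-map⁺ fsuc (∈-allFinL x))

length-allFinL : ∀ m → length (allFinL m) ≡ m
length-allFinL zero = refl
length-allFinL (suc m) = cong suc (trans (length-map fsuc (allFinL m)) (length-allFinL m))

unique-allFinL : ∀ m → Unique (allFinL m)
unique-allFinL zero = []
unique-allFinL (suc m) = All.tabulate zero≢ ∷ unique-map (unique-allFinL m) (λ _ _ → Fin.suc-injective)
  where
  zero≢ : ∀ {y} → y ∈ map fsuc (allFinL m) → fzero ≢ y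
  zero≢ y∈ refl with _ , _ , () ← ∈-map⁻ fsuc y∈

allVecs-suc : ∀ a m → allVecs (suc a) m ≡ cartesianProductWith _∷_ (allFinL m) (allVecs a m)
allVecs-suc a m = concatMap-map≡cartesianProductWith _∷_ (allFinL m) (allVecs a m)

∈-allVecs : ∀ {a m} (v : Vec (Fin m) a) → v ∈ allVecs a m
∈-allVecs [] = here refl
∈-allVecs {suc a} {m} (x ∷ v) = subst (x ∷ v ∈_) (sym (allVecs-suc a m))
  (∈-cartesianProductWith⁺ _∷_ (∈-allFinL x) (∈-allVecs v))

unique-allVecs : ∀ a m → Unique (allVecs a m)
unique-allVecs zero m = [] ∷ []
unique-allVecs (suc a) m = subst Unique (sym (allVecs-suc a m))
  (cartesianProductWith⁺ _∷_ Vec.∷-injective (unique-allFinL m) (unique-allVecs a m))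

∈-perms⁺ : ∀ {n} {π : Vec (Fin n) n} → IsPerm π → π ∈ perms n
∈-perms⁺ {π = π} = ∈-filter⁺ isPerm? (∈-allVecs π)

∈-perms⁻ : ∀ {n} {π : Vec (Fin n) n} → π ∈ perms n → IsPerm π
∈-perms⁻ {n} π∈ = proj₂ (∈-filter⁻ isPerm? {xs = allVecs n n} π∈)

unique-perms : ∀ n → Unique (perms n)
unique-perms n = filter⁺ isPerm? (unique-allVecs n n)

InjectionInto : ∀ {a m} → Pred (Fin m) 0ℓ → Vec (Fin m) a → Set
InjectionInto {a} P v = ((i j : Fin a) → lookup v i ≡ lookup v j → i ≡ j) × (∀ i → P (lookup v i))

injectionInto? : ∀ {a m} {P : Pred (Fin m) 0ℓ} → Decidable P → Decidable (InjectionInto {a} P)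
injectionInto? P? v =
  (Fin.all? λ i → Fin.all? λ j → (lookup v i Fin.≟ lookup v j) →-dec (i Fin.≟ j)) ×-dec Fin.all? (P? ∘ lookup v)

_∖_ : ∀ {m} → Pred (Fin m) 0ℓ → Fin m → Pred (Fin m) 0ℓ
(P ∖ x) y = y ≢ x × P y

∖? : ∀ {m} {P : Pred (Fin m) 0ℓ} → Decidable P → (x : Fin m) → Decidable (P ∖ x)
∖? P? x y = ¬? (y Fin.≟ x) ×-dec P? y

injectionInto-∷ : ∀ {a m} {P : Pred (Fin m) 0ℓ} (x : Fin m) (v : Vec (Fin m) a) →
  InjectionInto P (x ∷ v) ⇔ (P x × InjectionInto (P ∖ x) v)
injectionInto-∷ {P = P} x v = mk⇔ to from
  where
  to : InjectionInto P (x ∷ v) → P x × InjectionInto (P ∖ x) v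
  to (inj , inP) = inP fzero
                 , (λ i j e → Fin.suc-injective (inj (fsuc i) (fsuc j) e))
                 , (λ i → (λ vᵢ≡x → case inj fzero (fsuc i) (sym vᵢ≡x) of λ ()) , inP (fsuc i))
  from : P x × InjectionInto (P ∖ x) v → InjectionInto P (x ∷ v)
  from (px , inj , inP∖x) = inj′ , inP
    where
    inj′ : (i j : Fin _) → lookup (x ∷ v) i ≡ lookup (x ∷ v) j → i ≡ j
    inj′ fzero fzero _ = refl
    inj′ fzero (fsuc j) x≡vⱼ = ⊥-elim (proj₁ (inP∖x j) (sym x≡vⱼ))
    inj′ (fsuc i) fzero vᵢ≡x = ⊥-elim (proj₁ (inP∖x i) vᵢ≡x)
    inj′ (fsuc i) (fsuc j) e = cong fsuc (inj i j e)
    inP : ∀ i → P (lookup (x ∷ v) i)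
    inP fzero = px
    inP (fsuc i) = proj₂ (inP∖x i)

module _ {m} {P : Pred (Fin m) 0ℓ} (P? : Decidable P) where

  filter-∖-∉ : ∀ {x xs} → x ∉ xs → filter (∖? P? x) xs ≡ filter P? xs
  filter-∖-∉ {xs = []} _ = refl
  filter-∖-∉ {x} {y ∷ ys} x∉ with y Fin.≟ x
  ... | yes refl = ⊥-elim (x∉ (here refl))
  ... | no _ with P? y
  ...   | yes _ = cong (y ∷_) (filter-∖-∉ (x∉ ∘ there))
  ...   | no _ = filter-∖-∉ (x∉ ∘ there)

  length-filter-∖ : ∀ {x xs} → Unique xs → x ∈ xs → P x →
    length (filter P? xs) ≡ suc (length (filter (∖? P? x) xs))
  length-filter-∖ {x} {y ∷ ys} (y∉ys ∷ ys!) x∈ px with y Fin.≟ x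
  length-filter-∖ {x} {y ∷ ys} (y∉ys ∷ ys!) x∈ px | yes refl with P? y
  ... | yes _ = cong (suc ∘ length) (sym (filter-∖-∉ λ y∈ys → All.lookup y∉ys y∈ys refl))
  ... | no ¬px = ⊥-elim (¬px px)
  length-filter-∖ {x} {y ∷ ys} (y∉ys ∷ ys!) (here x≡y) px | no y≢x = ⊥-elim (y≢x (sym x≡y))
  length-filter-∖ {x} {y ∷ ys} (y∉ys ∷ ys!) (there x∈) px | no y≢x with P? y
  ... | yes _ = cong suc (length-filter-∖ ys! x∈ px)
  ... | no _ = length-filter-∖ ys! x∈ px

length-injectionsInto : ∀ a {m} {P : Pred (Fin m) 0ℓ} (P? : Decidable P) →
  length (filter P? (allFinL m)) ≡ a → length (filter (injectionInto? P?) (allVecs a m)) ≡ a !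
length-injectionsInto zero P? _ = refl
length-injectionsInto (suc a) {m} {P} P? |P|≡1+a = begin
  length (filter (injectionInto? P?) (allVecs (suc a) m))
    ≡⟨ cong (length ∘ filter (injectionInto? P?)) (allVecs-suc a m) ⟩
  length (filter (injectionInto? P?) (cartesianProductWith _∷_ (allFinL m) (allVecs a m)))
    ≡⟨ length-filter-cartesianProductWith P? (injectionInto? P?) _∷_ (allVecs a m) (a !) count-P count-¬P (allFinL m) ⟩
  length (filter P? (allFinL m)) * a !
    ≡⟨ cong (_* a !) |P|≡1+a ⟩
  suc a * a ! ∎
  where
  open ≡-Reasoning
  count-P : ∀ x → P x → length (filter (injectionInto? P? ∘ (x ∷_)) (allVecs a m)) ≡ a !
  count-P x px = begin
    length (filter (injectionInto? P? ∘ (x ∷_)) (allVecs a m))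
      ≡⟨ cong length (filter-≐ (injectionInto? P? ∘ (x ∷_)) (injectionInto? (∖? P? x))
           ((λ inj → proj₂ (Equivalence.to (injectionInto-∷ {P = P} x _) inj))
           , (λ inj → Equivalence.from (injectionInto-∷ {P = P} x _) (px , inj))) (allVecs a m)) ⟩
    length (filter (injectionInto? (∖? P? x)) (allVecs a m))
      ≡⟨ length-injectionsInto a (∖? P? x)
           (suc-injective (trans (sym (length-filter-∖ P? (unique-allFinL m) (∈-allFinL x) px)) |P|≡1+a)) ⟩
    a ! ∎
  count-¬P : ∀ x → ¬ P x → length (filter (injectionInto? P? ∘ (x ∷_)) (allVecs a m)) ≡ 0
  count-¬P x ¬px = cong length (filter-none (injectionInto? P? ∘ (x ∷_))
    (All.universal (λ v inj → ¬px (proj₁ (Equivalence.to (injectionInto-∷ {P = P} x v) inj))) (allVecs a m)))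

length-perms : ∀ n → length (perms n) ≡ n !
length-perms n = begin
  length (filter isPerm? (allVecs n n))
    ≡⟨ cong length (filter-≐ isPerm? (injectionInto? U?) ((_, _) , proj₁) (allVecs n n)) ⟩
  length (filter (injectionInto? U?) (allVecs n n))
    ≡⟨ length-injectionsInto n U? (trans (cong length (filter-all U? (All.universal (λ _ → _) (allFinL n)))) (length-allFinL n)) ⟩
  n ! ∎
  where open ≡-Reasoning

injective⇒surjective : ∀ {d} {f : Fin d → Fin d} → Injective _≡_ _≡_ f → ∀ y → ∃ λ x → f x ≡ y
injective⇒surjective {suc d} {f} f-inj y with Fin.any? (λ x → f x Fin.≟ y)
... | yes found = found
... | no ¬found =
  let i , j , i<j , gᵢ≡gⱼ = Fin.pigeonhole (n<1+n d) g
  in ⊥-elim (Fin.<-irrefl (f-inj (Fin.punchOut-injective (y≢f i) (y≢f j) gᵢ≡gⱼ)) i<j)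
  where
  y≢f : ∀ x → y ≢ f x
  y≢f x y≡fx = ¬found (x , sym y≡fx)
  g : Fin (suc d) → Fin d
  g x = punchOut (y≢f x)

length-filter-∘-injective : ∀ {d e} {P : Pred (Fin e) 0ℓ} (P? : Decidable P) {σ : Fin d → Fin e} →
  Injective _≡_ _≡_ σ → length (filter (P? ∘ σ) (allFinL d)) ≤ length (filter P? (allFinL e))
length-filter-∘-injective {d} {e} P? {σ} σ-inj = subst (_≤ _) (length-map σ (filter (P? ∘ σ) (allFinL d)))
  (unique⇒length-≤ Fin._≟_ (unique-map (filter⁺ (P? ∘ σ) (unique-allFinL d)) (λ _ _ → σ-inj)) image⊆)
  where
  image⊆ : map σ (filter (P? ∘ σ) (allFinL d)) ⊆ filter P? (allFinL e)
  image⊆ z∈ with x , x∈ , refl ← ∈-map⁻ σ z∈ =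
    ∈-filter⁺ P? (∈-allFinL (σ x)) (proj₂ (∈-filter⁻ (P? ∘ σ) {xs = allFinL d} x∈))

length-filter-∘-bijective : ∀ {e} {P : Pred (Fin e) 0ℓ} (P? : Decidable P) {σ : Fin e → Fin e} →
  Injective _≡_ _≡_ σ → length (filter (P? ∘ σ) (allFinL e)) ≡ length (filter P? (allFinL e))
length-filter-∘-bijective {e} {P} P? {σ} σ-inj = ≤-antisym (length-filter-∘-injective P? σ-inj) (begin
  length (filter P? (allFinL e))             ≡⟨ cong length (filter-≐ P? (P? ∘ σ ∘ σ⁻¹) P≐P∘σ∘σ⁻¹ (allFinL e)) ⟩
  length (filter (P? ∘ σ ∘ σ⁻¹) (allFinL e)) ≤⟨ length-filter-∘-injective (P? ∘ σ) σ⁻¹-injective ⟩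
  length (filter (P? ∘ σ) (allFinL e))       ∎)
  where
  open ≤-Reasoning
  σ⁻¹ : Fin e → Fin e
  σ⁻¹ y = proj₁ (injective⇒surjective σ-inj y)
  σσ⁻¹ : ∀ y → σ (σ⁻¹ y) ≡ y
  σσ⁻¹ y = proj₂ (injective⇒surjective σ-inj y)
  P≐P∘σ∘σ⁻¹ : P ≐ (P ∘ σ ∘ σ⁻¹)
  P≐P∘σ∘σ⁻¹ = (λ {y} → subst P (sym (σσ⁻¹ y))) , (λ {y} → subst P (σσ⁻¹ y))
  σ⁻¹-injective : Injective _≡_ _≡_ σ⁻¹
  σ⁻¹-injective {y} {y′} e = trans (sym (σσ⁻¹ y)) (trans (cong σ e) (σσ⁻¹ y′))

OrderIsomorphic : ∀ {d} → (Fin d → ℕ) → (Fin d → ℕ) → Set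
OrderIsomorphic f g = ∀ x y → (f x < f y → g x < g y) × (g x < g y → f x < f y)

module _ {d : ℕ} where

  orderIsomorphic-sym : {f g : Fin d → ℕ} → OrderIsomorphic f g → OrderIsomorphic g f
  orderIsomorphic-sym f≅g x y = swap (f≅g x y)

  orderIsomorphic-trans : {f g h : Fin d → ℕ} → OrderIsomorphic f g → OrderIsomorphic g h → OrderIsomorphic f h
  orderIsomorphic-trans f≅g g≅h x y = proj₁ (g≅h x y) ∘ proj₁ (f≅g x y) , proj₂ (f≅g x y) ∘ proj₂ (g≅h x y)

  ≗⇒orderIsomorphic : {f g : Fin d → ℕ} → f ≗ g → OrderIsomorphic f g
  ≗⇒orderIsomorphic f≗g x y = subst₂ _<_ (f≗g x) (f≗g y) , subst₂ _<_ (sym (f≗g x)) (sym (f≗g y))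

  orderIsomorphic-∘ : ∀ {e} {f g : Fin d → ℕ} → OrderIsomorphic f g → (ι : Fin e → Fin d) →
    OrderIsomorphic (f ∘ ι) (g ∘ ι)
  orderIsomorphic-∘ f≅g ι x y = f≅g (ι x) (ι y)

rank : ∀ {d} → (Fin d → ℕ) → Fin d → ℕ
rank {d} c z = length (filter (λ w → c w <? c z) (allFinL d))

rank-cong : ∀ {d} {f g : Fin d → ℕ} → OrderIsomorphic f g → rank f ≗ rank g
rank-cong {d} {f} {g} f≅g x =
  cong length (filter-≐ (λ w → f w <? f x) (λ w → g w <? g x) (proj₁ (f≅g _ x) , proj₂ (f≅g _ x)) (allFinL d))

rank-mono-< : ∀ {d} (c : Fin d → ℕ) {z z′} → c z < c z′ → rank c z < rank c z′
rank-mono-< c {z} {z′} cz<cz′ = length-filter-mono-< (λ w → c w <? c z) (λ w → c w <? c z′)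
  (λ cw<cz → <-trans cw<cz cz<cz′) (∈-allFinL z) cz<cz′ (<-irrefl refl)

rank-injective : ∀ {d} {c : Fin d → ℕ} → Injective _≡_ _≡_ c → Injective _≡_ _≡_ (rank c)
rank-injective {c = c} c-inj {z} {z′} rz≡rz′ with <-cmp (c z) (c z′)
... | tri< cz<cz′ _ _ = ⊥-elim (<-irrefl rz≡rz′ (rank-mono-< c cz<cz′))
... | tri≈ _ cz≡cz′ _ = c-inj cz≡cz′
... | tri> _ _ cz>cz′ = ⊥-elim (<-irrefl (sym rz≡rz′) (rank-mono-< c cz>cz′))

-- Two relabellings giving the same pattern are equal: the rank of c (σ x) among the values of c is
-- the rank of x in the pattern of c ∘ σ.
orderIsomorphic-∘⇒≗ : ∀ {d} {c : Fin d → ℕ} {σ σ′ : Fin d → Fin d} → Injective _≡_ _≡_ c →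
  Injective _≡_ _≡_ σ → Injective _≡_ _≡_ σ′ → OrderIsomorphic (c ∘ σ) (c ∘ σ′) → σ ≗ σ′
orderIsomorphic-∘⇒≗ {c = c} {σ} {σ′} c-inj σ-inj σ′-inj c∘σ≅c∘σ′ x = rank-injective c-inj (begin
  rank c (σ x)    ≡⟨ length-filter-∘-bijective (λ w → c w <? c (σ x)) σ-inj ⟨
  rank (c ∘ σ) x  ≡⟨ rank-cong c∘σ≅c∘σ′ x ⟩
  rank (c ∘ σ′) x ≡⟨ length-filter-∘-bijective (λ w → c w <? c (σ′ x)) σ′-inj ⟩
  rank c (σ′ x)   ∎)
  where open ≡-Reasoning

module _ {n} (π : Vec (Fin n) n) where

  at-< : ∀ {p} (p<n : p < n) → at π p ≡ toℕ (lookup π (fromℕ< p<n))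
  at-< {p} p<n with p <? n
  ... | yes _ = refl
  ... | no p≮n = ⊥-elim (p≮n p<n)

  at-≥ : ∀ {p} → n ≤ p → at π p ≡ 0
  at-≥ {p} n≤p with p <? n
  ... | yes p<n = ⊥-elim (<⇒≱ p<n n≤p)
  ... | no _ = refl

  at-toℕ : ∀ i → at π (toℕ i) ≡ toℕ (lookup π i)
  at-toℕ i = trans (at-< (Fin.toℕ<n i)) (cong (toℕ ∘ lookup π) (Fin.fromℕ<-toℕ i (Fin.toℕ<n i)))

  at-injective : IsPerm π → ∀ {p p′} → p < n → p′ < n → at π p ≡ at π p′ → p ≡ p′
  at-injective π-perm {p} {p′} p<n p′<n e = begin
    p                        ≡⟨ Fin.toℕ-fromℕ< p<n ⟨
    toℕ (fromℕ< p<n)         ≡⟨ cong toℕ (π-perm _ _ (Fin.toℕ-injective (trans (sym (at-< p<n)) (trans e (at-< p′<n))))) ⟩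
    toℕ (fromℕ< p′<n)        ≡⟨ Fin.toℕ-fromℕ< p′<n ⟩
    p′                       ∎
    where open ≡-Reasoning

lookup-ext : ∀ {a} {u v : Vec A a} → (∀ i → lookup u i ≡ lookup v i) → u ≡ v
lookup-ext {u = u} {v} u≗v = begin
  u                   ≡⟨ Vec.tabulate∘lookup u ⟨
  tabulate (lookup u) ≡⟨ Vec.tabulate-cong u≗v ⟩
  tabulate (lookup v) ≡⟨ Vec.tabulate∘lookup v ⟩
  v                   ∎
  where open ≡-Reasoning

at-ext : ∀ {n} {π π′ : Vec (Fin n) n} → (∀ p → at π p ≡ at π′ p) → π ≡ π′
at-ext {π = π} {π′} π≗π′ =
  lookup-ext (λ i → Fin.toℕ-injective (trans (sym (at-toℕ π i)) (trans (π≗π′ (toℕ i)) (at-toℕ π′ i))))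

-- OrderIsoWindows k s t π unfolds to OrderIsomorphic (window π s) (window π t).
window : ∀ {n k} → Vec (Fin n) n → ℕ → Fin k → ℕ
window π s a = at π (s + toℕ a)

OutsideBlock : ℕ → ℕ → ℕ → Set
OutsideBlock b d p = p < b ⊎ b + d ≤ p

data BlockView (b d p : ℕ) : Set where
  inside  : (x : Fin d) → p ≡ b + toℕ x → BlockView b d p
  outside : OutsideBlock b d p → BlockView b d p

blockView : ∀ b d p → BlockView b d p
blockView b d p with b ≤? p
... | no b≰p = outside (inj₁ (≰⇒> b≰p))
... | yes b≤p with p ∸ b <? d
...   | yes p∸b<d = inside (fromℕ< p∸b<d) (trans (sym (m+[n∸m]≡n b≤p)) (cong (b +_) (sym (Fin.toℕ-fromℕ< p∸b<d))))
...   | no p∸b≮d = outside (inj₂ (subst (b + d ≤_) (m+[n∸m]≡n b≤p) (+-monoʳ-≤ b (≮⇒≥ p∸b≮d))))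

inBlock-< : ∀ b {d} (x : Fin d) → b + toℕ x < b + d
inBlock-< b x = +-monoʳ-< b (Fin.toℕ<n x)

inBlock-¬outside : ∀ b {d} (x : Fin d) → ¬ OutsideBlock b d (b + toℕ x)
inBlock-¬outside b x (inj₁ b+x<b) = <⇒≱ b+x<b (m≤m+n b _)
inBlock-¬outside b x (inj₂ b+d≤b+x) = <⇒≱ (inBlock-< b x) b+d≤b+x

module BlockPermutation {n d} (b : ℕ) (b+d≤n : b + d ≤ n) where

  permutePosition : Vec (Fin d) d → ℕ → ℕ
  permutePosition σ p with blockView b d p
  ... | inside x _ = b + toℕ (lookup σ x)
  ... | outside _ = p

  permutePosition-inside : ∀ σ x → permutePosition σ (b + toℕ x) ≡ b + toℕ (lookup σ x)
  permutePosition-inside σ x with blockView b d (b + toℕ x)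
  ... | outside o = ⊥-elim (inBlock-¬outside b x o)
  ... | inside x′ e with Fin.toℕ-injective (+-cancelˡ-≡ b _ _ e)
  ...   | refl = refl

  permutePosition-outside : ∀ σ {p} → OutsideBlock b d p → permutePosition σ p ≡ p
  permutePosition-outside σ {p} o with blockView b d p
  ... | outside _ = refl
  ... | inside x refl = ⊥-elim (inBlock-¬outside b x o)

  permutePosition-< : ∀ σ {p} → p < n → permutePosition σ p < n
  permutePosition-< σ {p} p<n with blockView b d p
  ... | inside x _ = <-≤-trans (inBlock-< b (lookup σ x)) b+d≤n
  ... | outside _ = p<n

  permutePosition-injective : ∀ {σ} → IsPerm σ → Injective _≡_ _≡_ (permutePosition σ)
  permutePosition-injective {σ} σ-perm {p} {p′} e with blockView b d p | blockView b d p′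
  ... | outside _ | outside _ = e
  ... | inside x refl | inside x′ refl = cong (λ y → b + toℕ y) (σ-perm x x′ (Fin.toℕ-injective (+-cancelˡ-≡ b _ _ e)))
  ... | inside x _ | outside o = ⊥-elim (inBlock-¬outside b (lookup σ x) (subst (OutsideBlock b d) (sym e) o))
  ... | outside o | inside x′ _ = ⊥-elim (inBlock-¬outside b (lookup σ x′) (subst (OutsideBlock b d) e o))

  permuteBlock : Vec (Fin n) n → Vec (Fin d) d → Vec (Fin n) n
  permuteBlock π σ = tabulate (λ i → lookup π (fromℕ< (permutePosition-< σ (Fin.toℕ<n i))))

  at-permuteBlock : ∀ π σ p → at (permuteBlock π σ) p ≡ at π (permutePosition σ p)
  at-permuteBlock π σ p = by-range (p <? n)
    where
    open ≡-Reasoning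
    by-range : Dec (p < n) → at (permuteBlock π σ) p ≡ at π (permutePosition σ p)
    by-range (no p≮n) = begin
      at (permuteBlock π σ) p    ≡⟨ at-≥ (permuteBlock π σ) (≮⇒≥ p≮n) ⟩
      0                          ≡⟨ at-≥ π (≮⇒≥ p≮n) ⟨
      at π p                     ≡⟨ cong (at π) (permutePosition-outside σ (inj₂ (≤-trans b+d≤n (≮⇒≥ p≮n)))) ⟨
      at π (permutePosition σ p) ∎
    by-range (yes p<n) = begin
      at (permuteBlock π σ) p
        ≡⟨ at-< (permuteBlock π σ) p<n ⟩
      toℕ (lookup (permuteBlock π σ) (fromℕ< p<n))
        ≡⟨ cong toℕ (Vec.lookup∘tabulate _ (fromℕ< p<n)) ⟩
      toℕ (lookup π (fromℕ< (permutePosition-< σ (Fin.toℕ<n (fromℕ< p<n)))))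
        ≡⟨ cong (toℕ ∘ lookup π) (Fin.fromℕ<-cong _ _ (cong (permutePosition σ) (Fin.toℕ-fromℕ< p<n)) _ (permutePosition-< σ p<n)) ⟩
      toℕ (lookup π (fromℕ< (permutePosition-< σ p<n)))
        ≡⟨ at-< π (permutePosition-< σ p<n) ⟨
      at π (permutePosition σ p) ∎

  permuteBlock-outside : ∀ π σ {p} → OutsideBlock b d p → at (permuteBlock π σ) p ≡ at π p
  permuteBlock-outside π σ o = trans (at-permuteBlock π σ _) (cong (at π) (permutePosition-outside σ o))

  permuteBlock-inside : ∀ π σ x → at (permuteBlock π σ) (b + toℕ x) ≡ at π (b + toℕ (lookup σ x))
  permuteBlock-inside π σ x = trans (at-permuteBlock π σ _) (cong (at π) (permutePosition-inside σ x))

  permuteBlock-isPerm : ∀ {π σ} → IsPerm π → IsPerm σ → IsPerm (permuteBlock π σ)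
  permuteBlock-isPerm {π} {σ} π-perm σ-perm i j e = Fin.toℕ-injective (permutePosition-injective σ-perm
    (at-injective π π-perm (permutePosition-< σ (Fin.toℕ<n i)) (permutePosition-< σ (Fin.toℕ<n j)) (begin
      at π (permutePosition σ (toℕ i))   ≡⟨ at-permuteBlock π σ (toℕ i) ⟨
      at (permuteBlock π σ) (toℕ i)      ≡⟨ at-toℕ (permuteBlock π σ) i ⟩
      toℕ (lookup (permuteBlock π σ) i)  ≡⟨ cong toℕ e ⟩
      toℕ (lookup (permuteBlock π σ) j)  ≡⟨ at-toℕ (permuteBlock π σ) j ⟨
      at (permuteBlock π σ) (toℕ j)      ≡⟨ at-permuteBlock π σ (toℕ j) ⟩
      at π (permutePosition σ (toℕ j))   ∎)))
    where open ≡-Reasoning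

  permuteBlock-cancelʳ : ∀ {π π′ σ} → IsPerm σ → permuteBlock π σ ≡ permuteBlock π′ σ → π ≡ π′
  permuteBlock-cancelʳ {π} {π′} {σ} σ-perm πσ≡π′σ = at-ext agree
    where
    agree : ∀ q → at π q ≡ at π′ q
    agree q with blockView b d q
    ... | outside o = begin
      at π q                    ≡⟨ permuteBlock-outside π σ o ⟨
      at (permuteBlock π σ) q   ≡⟨ cong (λ ρ → at ρ q) πσ≡π′σ ⟩
      at (permuteBlock π′ σ) q  ≡⟨ permuteBlock-outside π′ σ o ⟩
      at π′ q                   ∎
      where open ≡-Reasoning
    ... | inside y refl with x , refl ← injective⇒surjective (λ {i} {j} → σ-perm i j) y = begin
      at π (b + toℕ (lookup σ x))         ≡⟨ permuteBlock-inside π σ x ⟨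
      at (permuteBlock π σ) (b + toℕ x)   ≡⟨ cong (λ ρ → at ρ (b + toℕ x)) πσ≡π′σ ⟩
      at (permuteBlock π′ σ) (b + toℕ x)  ≡⟨ permuteBlock-inside π′ σ x ⟩
      at π′ (b + toℕ (lookup σ x))        ∎
      where open ≡-Reasoning

  module _ {s} (s+d≤b : s + d ≤ b) where

    permuteBlock-injective : ∀ {π π′ σ σ′} → IsPerm π → IsPerm σ → IsPerm σ′ →
      OrderIsoWindows d s b π → OrderIsoWindows d s b π′ →
      permuteBlock π σ ≡ permuteBlock π′ σ′ → π ≡ π′ × σ ≡ σ′
    permuteBlock-injective {π} {π′} {σ} {σ′} π-perm σ-perm σ′-perm π-iso π′-iso πσ≡π′σ′ = π≡π′ , σ≡σ′
      where
      open ≡-Reasoning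
      s+x<b : ∀ (x : Fin d) → s + toℕ x < b
      s+x<b x = <-≤-trans (inBlock-< s x) s+d≤b
      left≗ : window π s ≗ window π′ s
      left≗ x = begin
        at π (s + toℕ x)                    ≡⟨ permuteBlock-outside π σ (inj₁ (s+x<b x)) ⟨
        at (permuteBlock π σ) (s + toℕ x)   ≡⟨ cong (λ ρ → at ρ (s + toℕ x)) πσ≡π′σ′ ⟩
        at (permuteBlock π′ σ′) (s + toℕ x) ≡⟨ permuteBlock-outside π′ σ′ (inj₁ (s+x<b x)) ⟩
        at π′ (s + toℕ x)                   ∎
      block≗ : window π b ∘ lookup σ ≗ window π′ b ∘ lookup σ′
      block≗ x = begin
        at π (b + toℕ (lookup σ x))         ≡⟨ permuteBlock-inside π σ x ⟨
        at (permuteBlock π σ) (b + toℕ x)   ≡⟨ cong (λ ρ → at ρ (b + toℕ x)) πσ≡π′σ′ ⟩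
        at (permuteBlock π′ σ′) (b + toℕ x) ≡⟨ permuteBlock-inside π′ σ′ x ⟩
        at π′ (b + toℕ (lookup σ′ x))       ∎
      left-injective : Injective _≡_ _≡_ (window π s)
      left-injective {x} {y} e = Fin.toℕ-injective (+-cancelˡ-≡ s _ _
        (at-injective π π-perm (<-≤-trans (s+x<b x) (m+n≤o⇒m≤o b b+d≤n)) (<-≤-trans (s+x<b y) (m+n≤o⇒m≤o b b+d≤n)) e))
      same-pattern : OrderIsomorphic (window π s ∘ lookup σ) (window π s ∘ lookup σ′)
      same-pattern =
        orderIsomorphic-trans (orderIsomorphic-∘ π-iso (lookup σ)) (
        orderIsomorphic-trans (≗⇒orderIsomorphic block≗) (
        orderIsomorphic-trans (orderIsomorphic-sym (orderIsomorphic-∘ π′-iso (lookup σ′)))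
                              (≗⇒orderIsomorphic (sym ∘ left≗ ∘ lookup σ′))))
      σ≡σ′ : σ ≡ σ′
      σ≡σ′ = lookup-ext (orderIsomorphic-∘⇒≗ left-injective (λ {x} {y} → σ-perm x y) (λ {x} {y} → σ′-perm x y) same-pattern)
      π≡π′ : π ≡ π′
      π≡π′ = permuteBlock-cancelʳ σ′-perm (subst (λ τ → permuteBlock π τ ≡ permuteBlock π′ σ′) σ≡σ′ πσ≡π′σ′)

    length-orderIsoWindows-×-≤ : {Q : Pred (Vec (Fin n) n) 0ℓ} (Q? : Decidable Q) →
      (∀ {π π′} → (∀ {p} → OutsideBlock b d p → at π p ≡ at π′ p) → Q π → Q π′) →
      length (filter (λ π → orderIsoWindows? d s b π ×-dec Q? π) (perms n)) * d ! ≤ length (filter Q? (perms n))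
    length-orderIsoWindows-×-≤ {Q} Q? Q-local = subst (λ m → length (filter isoQ? (perms n)) * m ≤ _) (length-perms d)
      (length-*-≤ permuteBlock (Vec.≡-dec Fin._≟_) (filter⁺ isoQ? (unique-perms n)) (unique-perms d) injective image∈)
      where
      isoQ? : Decidable (λ π → OrderIsoWindows d s b π × Q π)
      isoQ? π = orderIsoWindows? d s b π ×-dec Q? π
      member : ∀ {π} → π ∈ filter isoQ? (perms n) → IsPerm π × OrderIsoWindows d s b π × Q π
      member {π} π∈ with π∈perms , iso , qπ ← ∈-filter⁻ isoQ? {xs = perms n} π∈ = ∈-perms⁻ π∈perms , iso , qπ
      injective : ∀ {π π′ σ σ′} → π ∈ filter isoQ? (perms n) → π′ ∈ filter isoQ? (perms n) → σ ∈ perms d → σ′ ∈ perms d →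
        permuteBlock π σ ≡ permuteBlock π′ σ′ → π ≡ π′ × σ ≡ σ′
      injective π∈ π′∈ σ∈ σ′∈ = permuteBlock-injective (proj₁ (member π∈)) (∈-perms⁻ σ∈) (∈-perms⁻ σ′∈)
        (proj₁ (proj₂ (member π∈))) (proj₁ (proj₂ (member π′∈)))
      image∈ : ∀ {π σ} → π ∈ filter isoQ? (perms n) → σ ∈ perms d → permuteBlock π σ ∈ filter Q? (perms n)
      image∈ {π} {σ} π∈ σ∈ with π-perm , _ , qπ ← member π∈ =
        ∈-filter⁺ Q? (∈-perms⁺ (permuteBlock-isPerm {π} {σ} π-perm (∈-perms⁻ σ∈)))
          (Q-local (λ o → sym (permuteBlock-outside π σ o)) qπ)

blockStarts : ℕ → ℕ → ℕ → List ℕ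
blockStarts d b zero = []
blockStarts d b (suc q) = b ∷ blockStarts d (b + d) q

blockStarts-≥ : ∀ d b q → All (b ≤_) (blockStarts d b q)
blockStarts-≥ d b zero = []
blockStarts-≥ d b (suc q) = ≤-refl ∷ All.map (≤-trans (m≤m+n b d)) (blockStarts-≥ d (b + d) q)

BlocksIso : ∀ {n} → ℕ → ℕ → ℕ → ℕ → Vec (Fin n) n → Set
BlocksIso d s b q π = All (λ t → OrderIsoWindows d s t π) (blockStarts d b q)

blocksIso? : ∀ {n} d s b q → Decidable (BlocksIso {n} d s b q)
blocksIso? d s b q π = All.all? (λ t → orderIsoWindows? d s t π) (blockStarts d b q)

orderIsoWindows-local : ∀ {n d s t} {π π′ : Vec (Fin n) n} →
  window {k = d} π s ≗ window π′ s → window {k = d} π t ≗ window π′ t →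
  OrderIsoWindows d s t π → OrderIsoWindows d s t π′
orderIsoWindows-local left≗ right≗ iso =
  orderIsomorphic-trans (≗⇒orderIsomorphic (sym ∘ left≗)) (orderIsomorphic-trans iso (≗⇒orderIsomorphic right≗))

blocksIso-local : ∀ {n d s b q} {π π′ : Vec (Fin n) n} → s + d ≤ b →
  (∀ {p} → OutsideBlock b d p → at π p ≡ at π′ p) → BlocksIso d s (b + d) q π → BlocksIso d s (b + d) q π′
blocksIso-local {d = d} {s} {b} {q} {π} {π′} s+d≤b agree isos =
  All.zipWith (λ (b+d≤t , iso) → orderIsoWindows-local {s = s} {π = π} {π′}
                 (λ x → agree (inj₁ (<-≤-trans (inBlock-< s x) s+d≤b)))
                 (λ x → agree (inj₂ (≤-trans b+d≤t (m≤m+n _ _)))) iso)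
              (blockStarts-≥ d (b + d) q , isos)

module _ {n d s : ℕ} where

  length-blocksIso-≤ : ∀ q b → s + d ≤ b → b + q * d ≤ n →
    length (filter (blocksIso? d s b q) (perms n)) * (d !) ^ q ≤ n !
  length-blocksIso-≤ zero b _ _ = begin
    length (filter (blocksIso? d s b 0) (perms n)) * 1 ≡⟨ *-identityʳ _ ⟩
    length (filter (blocksIso? d s b 0) (perms n))     ≤⟨ length-filter (blocksIso? d s b 0) (perms n) ⟩
    length (perms n)                                   ≡⟨ length-perms n ⟩
    n !                                                ∎
    where open ≤-Reasoning
  length-blocksIso-≤ (suc q) b s+d≤b b+[1+q]d≤n = begin
    length (filter (blocksIso? d s b (suc q)) (perms n)) * (d ! * (d !) ^ q)
      ≡⟨ *-assoc (length (filter (blocksIso? d s b (suc q)) (perms n))) (d !) _ ⟨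
    length (filter (blocksIso? d s b (suc q)) (perms n)) * d ! * (d !) ^ q
      ≡⟨ cong (λ m → m * d ! * (d !) ^ q) (cong length (filter-≐ (blocksIso? d s b (suc q)) iso×blocks?
           ((λ { (iso ∷ isos) → iso , isos }) , λ (iso , isos) → iso ∷ isos) (perms n))) ⟩
    length (filter iso×blocks? (perms n)) * d ! * (d !) ^ q
      ≤⟨ *-monoˡ-≤ _ (BlockPermutation.length-orderIsoWindows-×-≤ b b+d≤n s+d≤b (blocksIso? d s (b + d) q) (λ {π} {π′} → blocksIso-local {π = π} {π′} s+d≤b)) ⟩
    length (filter (blocksIso? d s (b + d) q) (perms n)) * (d !) ^ q
      ≤⟨ length-blocksIso-≤ q (b + d) (≤-trans s+d≤b (m≤m+n b d)) (subst (_≤ n) (sym (+-assoc b d (q * d))) b+[1+q]d≤n) ⟩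
    n ! ∎
    where
    open ≤-Reasoning
    b+d≤n : b + d ≤ n
    b+d≤n = ≤-trans (+-monoʳ-≤ b (m≤m+n d (q * d))) b+[1+q]d≤n
    iso×blocks? : Decidable (λ π → OrderIsoWindows d s b π × BlocksIso d s (b + d) q π)
    iso×blocks? π = orderIsoWindows? d s b π ×-dec blocksIso? d s (b + d) q π

orderIsoWindows-shift : ∀ {n k e s t r} {π : Vec (Fin n) n} → r + e ≤ k →
  OrderIsoWindows k s t π → OrderIsoWindows e (s + r) (t + r) π
orderIsoWindows-shift {k = k} {e} {s} {t} {r} {π} r+e≤k iso = orderIsomorphic-trans
  (≗⇒orderIsomorphic (sym ∘ shifted s)) (orderIsomorphic-trans (orderIsomorphic-∘ iso ι) (≗⇒orderIsomorphic (shifted t)))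
  where
  ι : Fin e → Fin k
  ι x = fromℕ< (<-≤-trans (inBlock-< r x) r+e≤k)
  shifted : ∀ u → window π u ∘ ι ≗ window π (u + r)
  shifted u x = cong (at π) (trans (cong (u +_) (Fin.toℕ-fromℕ< _)) (sym (+-assoc u r (toℕ x))))

module _ {n k d s} {π : Vec (Fin n) n} (periodic : OrderIsoWindows k s (s + d) π) where

  blocksIso-from : ∀ q r → OrderIsoWindows d s (s + r) π → r + q * d ≤ k → BlocksIso d s (s + (r + d)) q π
  blocksIso-from zero r _ _ = []
  blocksIso-from (suc q) r iso r+[1+q]d≤k = next ∷ subst (λ b → BlocksIso d s b q π) (sym (+-assoc s (r + d) d))
    (blocksIso-from q (r + d) next (subst (_≤ k) (sym (+-assoc r d (q * d))) r+[1+q]d≤k))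
    where
    next : OrderIsoWindows d s (s + (r + d)) π
    next = subst (λ t → OrderIsoWindows d s t π) (trans (+-assoc s d r) (cong (s +_) (+-comm d r)))
      (orderIsomorphic-trans iso (orderIsoWindows-shift {s = s} {s + d} {π = π} (≤-trans (+-monoʳ-≤ r (m≤m+n d (q * d))) r+[1+q]d≤k) periodic))

  blocksIso-periodic : ∀ q → q * d ≤ k → BlocksIso d s (s + d) q π
  blocksIso-periodic q = blocksIso-from q 0 (≗⇒orderIsomorphic λ x → cong (λ u → at π (u + toℕ x)) (sym (+-identityʳ s)))

m≤[1+m/n]*n : ∀ m n .{{_ : NonZero n}} → m ≤ suc (m / n) * n
m≤[1+m/n]*n m n = begin
  m                 ≡⟨ m≡m%n+[m/n]*n m n ⟩
  m % n + m / n * n ≤⟨ +-monoˡ-≤ (m / n * n) (<⇒≤ (m%n<n m n)) ⟩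
  n + m / n * n     ∎
  where open ≤-Reasoning

[1+m/n]*n≤n+m : ∀ m n .{{_ : NonZero n}} → suc (m / n) * n ≤ n + m
[1+m/n]*n≤n+m m n = +-monoʳ-≤ n (m/n*n≤m m n)

^-distribʳ-* : ∀ m n o → (m * n) ^ o ≡ m ^ o * n ^ o
^-distribʳ-* m n zero = refl
^-distribʳ-* m n (suc o) = trans (cong (m * n *_) (^-distribʳ-* m n o)) ([m*n]*[o*p]≡[m*o]*[n*p] m n (m ^ o) (n ^ o))

m*n^q≤o⇒m^d*n^l≤o^d : ∀ {m n o q l} d .{{_ : NonZero n}} → l ≤ q * d → m * n ^ q ≤ o → m ^ d * n ^ l ≤ o ^ d
m*n^q≤o⇒m^d*n^l≤o^d {m} {n} {o} {q} {l} d l≤qd m*nᵠ≤o = begin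
  m ^ d * n ^ l        ≤⟨ *-monoʳ-≤ (m ^ d) (^-monoʳ-≤ n l≤qd) ⟩
  m ^ d * n ^ (q * d)  ≡⟨ cong (m ^ d *_) (^-*-assoc n q d) ⟨
  m ^ d * (n ^ q) ^ d  ≡⟨ ^-distribʳ-* m (n ^ q) d ⟨
  (m * n ^ q) ^ d      ≤⟨ ^-monoˡ-≤ d m*nᵠ≤o ⟩
  o ^ d                ∎
  where open ≤-Reasoning

window-end : ∀ s {k l} → l ≤ k → suc s + 2 * k ∸ l ∸ 1 ≡ s + (k ∸ l) + k
window-end s {k} {l} l≤k = begin
  suc s + 2 * k ∸ l ∸ 1  ≡⟨ cong (_∸ 1) (+-∸-assoc (suc s) (≤-trans l≤k (m≤m+n k (k + 0)))) ⟩
  s + (2 * k ∸ l)        ≡⟨ cong (s +_) (+-∸-comm (k + 0) l≤k) ⟩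
  s + (k ∸ l + (k + 0))  ≡⟨ cong (λ m → s + (k ∸ l + m)) (+-identityʳ k) ⟩
  s + (k ∸ l + k)        ≡⟨ +-assoc s (k ∸ l) k ⟨
  s + (k ∸ l) + k        ∎
  where open ≡-Reasoning

countI-*-≤ : ∀ n k l s q → q * (k ∸ l) ≤ k → s + (k ∸ l) + k ≤ n →
  countI n (suc s) l k * ((k ∸ l) !) ^ q ≤ n !
countI-*-≤ n k l s q q*d≤k end≤n = ≤-trans
  (*-monoˡ-≤ ((d !) ^ q) (length-filter-mono (Ijlk? (suc s) l k) (blocksIso? d s (s + d) q)
    (λ {π} periodic → blocksIso-periodic {d = d} {s} {π} periodic q q*d≤k) (perms n)))
  (length-blocksIso-≤ q (s + d) ≤-refl (≤-trans (+-monoʳ-≤ (s + d) q*d≤k) end≤n))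
  where
  d : ℕ
  d = k ∸ l

lemma2p6 : (n k l j : ℕ) → k < 2 * l → l + 2 ≤ k → 1 ≤ j → j + 2 * k ∸ l ∸ 1 ≤ n →
    countI n j l k ^ (k ∸ l) * ((k ∸ l) !) ^ l ≤ (n !) ^ (k ∸ l)
lemma2p6 n k l (suc s) _ l+2≤k _ end≤n =
  m*n^q≤o⇒m^d*n^l≤o^d {q = q} d {{d !≢0}} (m≤[1+m/n]*n l d)
  (countI-*-≤ n k l s q q*d≤k (subst (_≤ n) (window-end s (<⇒≤ l<k)) end≤n))
  where
  d : ℕ
  d = k ∸ l
  l<k : l < k
  l<k = <-≤-trans (m<m+n l z<s) l+2≤k
  instance
    d≢0 : NonZero d
    d≢0 = >-nonZero (m<n⇒0<n∸m l<k)
  q : ℕ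
  q = suc (l / d)
  q*d≤k : q * d ≤ k
  q*d≤k = ≤-trans ([1+m/n]*n≤n+m l d) (≤-reflexive (m∸n+n≡m (<⇒≤ l<k)))
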